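{- For every integer $k\geq 1$ and every complex $q$ with $|q|<1$, \[ \sum_{n = 1}^\infty \mathrm{FFW}_k (n) q^n=\sum_{j=0}^{k-1}\sum_{m=k}^{\infty}\frac{(-1)^mq^{m(m+1)/2}}{(q;q)_{m}(1-q^{m-j})}. \]
   Context: For a positive integer $n$, $\mathcal{D}(n)$ denotes the set of partitions of $n$ into distinct parts; for $\pi \in \mathcal{D}(n)$, $\#(\pi)$ is the number of parts of $\pi$ and $s_k(\pi)$ is the $k$th smallest part of $\pi$, with $s_k(\pi)=0$ if $\pi$ has fewer than $k$ parts. $\mathrm{FFW}_k(n) := \sum_{\pi \in \mathcal{D}(n)} (-1)^{\#(\pi)} s_k(\pi)$. Here $(a;q)_m=(1-a)(1-aq)\cdots(1-aq^{m-1})$. -}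

module Defs where

open import Data.Nat as ℕ using (ℕ; zero; suc; _∸_; _≟_)
open import Data.Nat.Divisibility using (_∣?_)
open import Data.Integer as ℤ using (ℤ; +_; -_; _+_; _*_)
open import Data.List using (List; []; _∷_; _++_; map; filter; length; upTo; foldr)
open import Data.Nat.ListAction as ListAction using ()
open import Relation.Nullary.Decidable using (does)
open import Data.Bool using (if_then_else_)

sublists : List ℕ → List (List ℕ)
sublists [] = [] ∷ []
sublists (x ∷ xs) = map (x ∷_) (sublists xs) ++ sublists xs

-- D(n): partitions of n into distinct parts, each written as the
-- strictly increasing list of its parts (parts drawn from 1..n).
D : ℕ → List (List ℕ)
D n = filter (λ π → ListAction.sum π ≟ n) (sublists (map suc (upTo n)))

-- s k π : the k-th smallest part (k ≥ 1), 0 if π has fewer than k parts.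
s : ℕ → List ℕ → ℕ
s zero _ = 0
s (suc k) [] = 0
s (suc zero) (x ∷ _) = x
s (suc (suc k)) (_ ∷ xs) = s (suc k) xs

neg1^ : ℕ → ℤ
neg1^ zero = + 1
neg1^ (suc m) = - neg1^ m

sumℤ : List ℤ → ℤ
sumℤ = foldr _+_ (+ 0)

FFW : ℕ → ℕ → ℤ
FFW k n = sumℤ (map (λ π → neg1^ (length π) * + s k π) (D n))

Series : Set
Series = ℕ → ℤ

_⊛_ : Series → Series → Series
(f ⊛ g) n = sumℤ (map (λ i → f i * g (n ∸ i)) (upTo (suc n)))

qpow : ℕ → Series
qpow e n = if does (n ≟ e) then + 1 else + 0

-- 1/(1 - q^a)  (used only for a ≥ 1)
geom : ℕ → Series
geom a n = if does (a ∣? n) then + 1 else + 0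

poch⁻¹ : ℕ → Series
poch⁻¹ zero = qpow 0
poch⁻¹ (suc m) = poch⁻¹ m ⊛ geom (suc m)

term : ℕ → ℕ → Series
term m j n = neg1^ m * (qpow (m ℕ.* suc m ℕ./ 2) ⊛ (poch⁻¹ m ⊛ geom (m ∸ j))) n

-- Partial sum Σ_{j=0}^{k-1} Σ_{m=k}^{k+M-1} term m j
rhsPartial : ℕ → ℕ → Series
rhsPartial k M n =
  sumℤ (map (λ j → sumℤ (map (λ i → term (k ℕ.+ i) j n) (upTo M))) (upTo k))

lhs : ℕ → Series
lhs k zero = + 0
lhs k (suc n) = FFW k (suc n)

{-# OPTIONS --safe #-}
module Submission where

-- Splitting the subsets π ⊆ {1, …, N+1} by whether 1 ∈ π, then deleting 1 and lowering the other
-- parts by one, shows that the generating function C_{N,m} of the m-element subsets by |π| satisfies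
-- C_{N+1,m} = q^m (C_{N,m-1} + C_{N,m}); weighting each π by its k-th smallest part, which rises by
-- one, gives W_{N+1,k,m} = q^m (C_{N,m-1} + W_{N,k-1,m-1} + C_{N,m} + W_{N,k,m}).
-- The products P_m = q^{m(m+1)/2}/(q;q)_m and H_{m,k} = Σ_{j<k} P_m/(1 - q^{m-j}) obey the same
-- recursions (multiply by 1 - q^m and use m(m+1)/2 = m + (m-1)m/2), and these recursions determine
-- all coefficients up to degree N, so C_{N,m} = P_m and W_{N,k,m} = H_{m,k} there. Finally
-- Σ_{m≥k} (-1)^m H_{m,k} = Σ_π (-1)^{#π} s_k(π) q^{|π|}, because for each π only m = #π contributes
-- and s_k(π) = 0 when #π < k.

open import Defs
open import Data.Nat using (ℕ; _≥_)
open import Data.Product using (∃-syntax)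
open import Relation.Binary.PropositionalEquality using (_≡_)

open import Algebra.Properties.CommutativeSemigroup using (interchange)
open import Data.Bool using (true; false; if_then_else_)
open import Data.Integer using (ℤ; +_; _+_; _*_; _-_)
import Data.Integer.Properties as ℤₚ
open import Data.Integer.Tactic.RingSolver using (solve-∀)
open import Data.List using (List; []; _∷_; _++_; [_]; map; filter; length; upTo; applyUpTo)
open import Data.List.Properties using (map-∘; map-++; map-applyUpTo; map-upTo; upTo-∷ʳ; length-map; length-upTo)
open import Data.List.Relation.Unary.All as All using (All; []; _∷_)
open import Data.List.Relation.Unary.All.Properties using (++⁺; map⁺)
open import Data.Nat as ℕ using (zero; suc; _≤_; _<_; _≟_; _<?_; z≤n; s≤s)
open import Data.Nat.Divisibility using (divides; _∣?_; _∣0; ∣-refl; ∣⇒≤; ∣m+n∣m⇒∣n; ∣m∣n⇒∣m+n)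
open import Data.Nat.DivMod using (+-distrib-/-∣ˡ; m*n/n≡m)
open import Data.Nat.Induction using (<-rec)
open import Data.Nat.ListAction using (sum)
import Data.Nat.Properties as ℕₚ
open import Data.Nat.Tactic.RingSolver as ℕ-Solver using ()
open import Data.Product using (_,_)
open import Function using (_∘_)
open import Relation.Binary.PropositionalEquality using (refl; sym; trans; cong; cong₂; subst; _≗_; module ≡-Reasoning)
open import Relation.Nullary using (Dec; yes; no; ¬_; does)
open import Relation.Nullary.Negation using (contradiction)
open import Relation.Unary using (Pred; Decidable)

open ≡-Reasoning

𝟙 : ∀ {p} {P : Set p} → Dec P → ℤ
𝟙 d = if does d then + 1 else + 0

𝟙-yes : ∀ {p} {P : Set p} (d : Dec P) → P → 𝟙 d ≡ + 1
𝟙-yes (yes _) _ = refl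
𝟙-yes (no ¬p) p = contradiction p ¬p

𝟙-no : ∀ {p} {P : Set p} (d : Dec P) → ¬ P → 𝟙 d ≡ + 0
𝟙-no (yes p) ¬p = contradiction p ¬p
𝟙-no (no _) _ = refl

𝟙-⇔ : ∀ {p q} {P : Set p} {Q : Set q} (d : Dec P) (e : Dec Q) → (P → Q) → (Q → P) → 𝟙 d ≡ 𝟙 e
𝟙-⇔ d (yes q) _ Q⇒P = 𝟙-yes d (Q⇒P q)
𝟙-⇔ d (no ¬q) P⇒Q _ = 𝟙-no d (¬q ∘ P⇒Q)

δ : ℕ → ℕ → ℤ
δ m n = 𝟙 (m ≟ n)

δ-+ : ∀ k {m n} → δ (k ℕ.+ m) (k ℕ.+ n) ≡ δ m n
δ-+ zero = refl
δ-+ (suc k) = δ-+ k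

δ-*-cong : ∀ {m n} {x y : ℤ} → (m ≡ n → x ≡ y) → δ m n * x ≡ δ m n * y
δ-*-cong {m} {n} {x} {y} eq with m ≟ n
... | yes m≡n = cong (δ m n *_) (eq m≡n)
... | no m≢n = trans (cong (_* x) (𝟙-no (m ≟ n) m≢n)) (cong (_* y) (sym (𝟙-no (m ≟ n) m≢n)))

-- Finite sums

∑ : ∀ {A : Set} → List A → (A → ℤ) → ℤ
∑ xs f = sumℤ (map f xs)

infix 5 ∑
syntax ∑ xs (λ x → e) = ∑[ x ∈ xs ] e

module _ {A : Set} where

  ∑-cong-All : {f g : A → ℤ} {xs : List A} → All (λ x → f x ≡ g x) xs → ∑ xs f ≡ ∑ xs g
  ∑-cong-All [] = refl
  ∑-cong-All (eq ∷ eqs) = cong₂ _+_ eq (∑-cong-All eqs)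

  ∑-cong : {f g : A → ℤ} (xs : List A) → (∀ x → f x ≡ g x) → ∑ xs f ≡ ∑ xs g
  ∑-cong xs eq = ∑-cong-All (All.universal eq xs)

  ∑-zero : (xs : List A) → ∑[ x ∈ xs ] + 0 ≡ + 0
  ∑-zero [] = refl
  ∑-zero (_ ∷ xs) = trans (ℤₚ.+-identityˡ _) (∑-zero xs)

  ∑-++ : (f : A → ℤ) (xs ys : List A) → ∑ (xs ++ ys) f ≡ ∑ xs f + ∑ ys f
  ∑-++ f [] ys = sym (ℤₚ.+-identityˡ _)
  ∑-++ f (x ∷ xs) ys = trans (cong (_+_ (f x)) (∑-++ f xs ys)) (sym (ℤₚ.+-assoc (f x) _ _))

  ∑-map : {B : Set} (f : B → ℤ) (g : A → B) (xs : List A) → ∑ (map g xs) f ≡ ∑[ x ∈ xs ] f (g x)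
  ∑-map f g xs = cong sumℤ (sym (map-∘ xs))

  ∑-+ : (f g : A → ℤ) (xs : List A) → ∑[ x ∈ xs ] (f x + g x) ≡ ∑ xs f + ∑ xs g
  ∑-+ f g [] = refl
  ∑-+ f g (x ∷ xs) =
    trans (cong (_+_ (f x + g x)) (∑-+ f g xs)) (interchange ℤₚ.+-commutativeSemigroup (f x) (g x) _ _)

  ∑-*ˡ : (c : ℤ) (f : A → ℤ) (xs : List A) → ∑[ x ∈ xs ] (c * f x) ≡ c * ∑ xs f
  ∑-*ˡ c f [] = sym (ℤₚ.*-zeroʳ c)
  ∑-*ˡ c f (x ∷ xs) = trans (cong (_+_ (c * f x)) (∑-*ˡ c f xs)) (sym (ℤₚ.*-distribˡ-+ c (f x) _))

  ∑-filter : ∀ {p} {P : Pred A p} (P? : Decidable P) (f : A → ℤ) (xs : List A) →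
             ∑ (filter P? xs) f ≡ ∑[ x ∈ xs ] (𝟙 (P? x) * f x)
  ∑-filter P? f [] = refl
  ∑-filter P? f (x ∷ xs) with does (P? x)
  ... | true = cong₂ _+_ (sym (ℤₚ.*-identityˡ (f x))) (∑-filter P? f xs)
  ... | false = trans (∑-filter P? f xs) (sym (ℤₚ.+-identityˡ _))

∑-swap : {A B : Set} (F : A → B → ℤ) (xs : List A) (ys : List B) →
         ∑[ x ∈ xs ] ∑[ y ∈ ys ] F x y ≡ ∑[ y ∈ ys ] ∑[ x ∈ xs ] F x y
∑-swap F [] ys = sym (∑-zero ys)
∑-swap F (x ∷ xs) ys = trans (cong (_+_ (∑ ys (F x))) (∑-swap F xs ys)) (sym (∑-+ (F x) _ ys))

∑-upTo-suc : (f : ℕ → ℤ) (n : ℕ) → ∑ (upTo (suc n)) f ≡ f 0 + (∑[ i ∈ upTo n ] f (suc i))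
∑-upTo-suc f n = cong (λ xs → f 0 + sumℤ xs) (trans (map-applyUpTo suc f n) (sym (map-upTo (f ∘ suc) n)))

∑-upTo-snoc : (f : ℕ → ℤ) (n : ℕ) → ∑ (upTo (suc n)) f ≡ ∑ (upTo n) f + f n
∑-upTo-snoc f n = begin
  ∑ (upTo (suc n)) f         ≡⟨ cong (λ xs → ∑ xs f) (upTo-∷ʳ n) ⟨
  ∑ (upTo n ++ [ n ]) f      ≡⟨ ∑-++ f (upTo n) [ n ] ⟩
  ∑ (upTo n) f + (f n + + 0) ≡⟨ cong (_+_ (∑ (upTo n) f)) (ℤₚ.+-identityʳ (f n)) ⟩
  ∑ (upTo n) f + f n         ∎

∑-upTo-δ : ∀ {d M} (g : ℕ → ℤ) → d < M → ∑[ i ∈ upTo M ] (δ d i * g i) ≡ g d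
∑-upTo-δ {zero} {suc M} g _ = begin
  ∑[ i ∈ upTo (suc M) ] (δ 0 i * g i) ≡⟨ ∑-upTo-suc (λ i → δ 0 i * g i) M ⟩
  + 1 * g 0 + (∑[ i ∈ upTo M ] + 0)    ≡⟨ cong₂ _+_ (ℤₚ.*-identityˡ (g 0)) (∑-zero (upTo M)) ⟩
  g 0 + + 0                           ≡⟨ ℤₚ.+-identityʳ (g 0) ⟩
  g 0                                 ∎
∑-upTo-δ {suc d} {suc M} g (s≤s d<M) = begin
  ∑[ i ∈ upTo (suc M) ] (δ (suc d) i * g i)     ≡⟨ ∑-upTo-suc (λ i → δ (suc d) i * g i) M ⟩
  + 0 + (∑[ i ∈ upTo M ] δ d i * g (suc i))   ≡⟨ ℤₚ.+-identityˡ _ ⟩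
  ∑[ i ∈ upTo M ] (δ d i * g (suc i))           ≡⟨ ∑-upTo-δ (g ∘ suc) d<M ⟩
  g (suc d)                                     ∎

-- Formal power series

infixl 6 _+ˢ_

_+ˢ_ : Series → Series → Series
(f +ˢ g) n = f n + g n

shift : ℕ → Series → Series
shift zero f n = f n
shift (suc e) f zero = + 0
shift (suc e) f (suc n) = shift e f n

shift-map₂ : (φ : ℤ → ℤ → ℤ) → φ (+ 0) (+ 0) ≡ + 0 →
             ∀ e (f g : Series) → shift e (λ y → φ (f y) (g y)) ≗ λ n → φ (shift e f n) (shift e g n)
shift-map₂ φ φ0 zero f g n = refl
shift-map₂ φ φ0 (suc e) f g zero = sym φ0
shift-map₂ φ φ0 (suc e) f g (suc n) = shift-map₂ φ φ0 e f g n

shift-zero : ∀ e → shift e (λ _ → + 0) ≗ λ _ → + 0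
shift-zero zero n = refl
shift-zero (suc e) zero = refl
shift-zero (suc e) (suc n) = shift-zero e n

shift-+ : ∀ e (f g : Series) → shift e (f +ˢ g) ≗ shift e f +ˢ shift e g
shift-+ = shift-map₂ _+_ refl

shift-- : ∀ e (f g : Series) → shift e (λ y → f y - g y) ≗ λ n → shift e f n - shift e g n
shift-- = shift-map₂ _-_ refl

shift-*ˡ : ∀ c e (f : Series) → shift e (λ y → c * f y) ≗ λ n → c * shift e f n
shift-*ˡ c e f = shift-map₂ (λ x _ → c * x) (ℤₚ.*-zeroʳ c) e f f

shift-*ʳ : ∀ c e (f : Series) → shift e (λ y → f y * c) ≗ λ n → shift e f n * c
shift-*ʳ c e f = shift-map₂ (λ x _ → x * c) refl e f f

shift-∑ : ∀ {A : Set} e (G : A → Series) (xs : List A) →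
          shift e (λ y → ∑[ x ∈ xs ] G x y) ≗ λ n → ∑[ x ∈ xs ] shift e (G x) n
shift-∑ e G [] = shift-zero e
shift-∑ e G (x ∷ xs) n =
  trans (shift-+ e (G x) (λ y → ∑[ x ∈ xs ] G x y) n) (cong (_+_ (shift e (G x) n)) (shift-∑ e G xs n))

shift-cong : ∀ e {f g : Series} → f ≗ g → shift e f ≗ shift e g
shift-cong zero eq n = eq n
shift-cong (suc e) eq zero = refl
shift-cong (suc e) eq (suc n) = shift-cong e eq n

shift-cong-≤ : ∀ e {f g : Series} {n} → (∀ {y} → y ≤ n → f y ≡ g y) → shift e f n ≡ shift e g n
shift-cong-≤ zero eq = eq ℕₚ.≤-refl
shift-cong-≤ (suc e) {n = zero} eq = refl
shift-cong-≤ (suc e) {n = suc n} eq = shift-cong-≤ e (eq ∘ ℕₚ.m≤n⇒m≤1+n)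

shift-suc-cong-< : ∀ e {f g : Series} {n} → (∀ {y} → y < n → f y ≡ g y) →
                   shift (suc e) f n ≡ shift (suc e) g n
shift-suc-cong-< e {n = zero} eq = refl
shift-suc-cong-< e {n = suc n} eq = shift-cong-≤ e (eq ∘ s≤s)

shift-shift : ∀ a b (f : Series) → shift a (shift b f) ≗ shift (a ℕ.+ b) f
shift-shift zero b f n = refl
shift-shift (suc a) b f zero = refl
shift-shift (suc a) b f (suc n) = shift-shift a b f n

shift-comm : ∀ a b (f : Series) → shift a (shift b f) ≗ shift b (shift a f)
shift-comm a b f n = begin
  shift a (shift b f) n ≡⟨ shift-shift a b f n ⟩
  shift (a ℕ.+ b) f n   ≡⟨ cong (λ e → shift e f n) (ℕₚ.+-comm a b) ⟩
  shift (b ℕ.+ a) f n   ≡⟨ shift-shift b a f n ⟨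
  shift b (shift a f) n ∎

shift-fix : ∀ e a {X Y : Series} → X ≗ Y +ˢ shift a X → shift e X ≗ shift e Y +ˢ shift a (shift e X)
shift-fix e a {X} {Y} eq n = begin
  shift e X n                             ≡⟨ shift-cong e eq n ⟩
  shift e (Y +ˢ shift a X) n              ≡⟨ shift-+ e Y (shift a X) n ⟩
  shift e Y n + shift e (shift a X) n     ≡⟨ cong (_+_ (shift e Y n)) (shift-comm e a X n) ⟩
  shift e Y n + shift a (shift e X) n     ∎

shift-at : ∀ e (f : Series) x → shift e f (e ℕ.+ x) ≡ f x
shift-at zero f x = refl
shift-at (suc e) f x = shift-at e f x

shift-below : ∀ e (f : Series) {n} → n < e → shift e f n ≡ + 0
shift-below (suc e) f {zero} _ = refl
shift-below (suc e) f {suc n} (s≤s n<e) = shift-below e f n<e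

δ-shift : ∀ m e → δ (m ℕ.+ e) ≗ shift e (δ m)
δ-shift m zero n = cong (λ k → δ k n) (ℕₚ.+-identityʳ m)
δ-shift m (suc e) n rewrite ℕₚ.+-suc m e with n
... | zero = refl
... | suc n = δ-shift m e n

⊛-suc : ∀ (f g : Series) n → (f ⊛ g) (suc n) ≡ f 0 * g (suc n) + ((f ∘ suc) ⊛ g) n
⊛-suc f g n = ∑-upTo-suc (λ i → f i * g (suc n ℕ.∸ i)) (suc n)

⊛-congʳ : ∀ (f : Series) {g h : Series} → g ≗ h → f ⊛ g ≗ f ⊛ h
⊛-congʳ f eq n = ∑-cong (upTo (suc n)) (λ i → cong (f i *_) (eq (n ℕ.∸ i)))

⊛-distribˡ-+ : ∀ (f g h : Series) → f ⊛ (g +ˢ h) ≗ (f ⊛ g) +ˢ (f ⊛ h)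
⊛-distribˡ-+ f g h n = begin
  ∑[ i ∈ upTo (suc n) ] f i * (g (n ℕ.∸ i) + h (n ℕ.∸ i))
    ≡⟨ ∑-cong (upTo (suc n)) (λ i → ℤₚ.*-distribˡ-+ (f i) _ _) ⟩
  ∑[ i ∈ upTo (suc n) ] (f i * g (n ℕ.∸ i) + f i * h (n ℕ.∸ i))
    ≡⟨ ∑-+ (λ i → f i * g (n ℕ.∸ i)) (λ i → f i * h (n ℕ.∸ i)) (upTo (suc n)) ⟩
  (f ⊛ g) n + (f ⊛ h) n ∎

⊛-zeroˡ : ∀ (g : Series) n → ((λ _ → + 0) ⊛ g) n ≡ + 0
⊛-zeroˡ g n = ∑-zero (upTo (suc n))

⊛-identityʳ : ∀ (f : Series) → f ⊛ qpow 0 ≗ f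
⊛-identityʳ f zero = trans (ℤₚ.+-identityʳ _) (ℤₚ.*-identityʳ (f 0))
⊛-identityʳ f (suc n) = begin
  (f ⊛ qpow 0) (suc n)                    ≡⟨ ⊛-suc f (qpow 0) n ⟩
  f 0 * + 0 + ((f ∘ suc) ⊛ qpow 0) n      ≡⟨ cong₂ _+_ (ℤₚ.*-zeroʳ (f 0)) (⊛-identityʳ (f ∘ suc) n) ⟩
  + 0 + f (suc n)                         ≡⟨ ℤₚ.+-identityˡ _ ⟩
  f (suc n)                               ∎

qpow-⊛ : ∀ e (g : Series) → qpow e ⊛ g ≗ shift e g
qpow-⊛ zero g zero = trans (ℤₚ.+-identityʳ _) (ℤₚ.*-identityˡ (g 0))
qpow-⊛ zero g (suc n) = begin
  (qpow 0 ⊛ g) (suc n)                    ≡⟨ ⊛-suc (qpow 0) g n ⟩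
  + 1 * g (suc n) + ((λ _ → + 0) ⊛ g) n   ≡⟨ cong₂ _+_ (ℤₚ.*-identityˡ (g (suc n))) (⊛-zeroˡ g n) ⟩
  g (suc n) + + 0                         ≡⟨ ℤₚ.+-identityʳ _ ⟩
  g (suc n)                               ∎
qpow-⊛ (suc e) g zero = refl
qpow-⊛ (suc e) g (suc n) = trans (⊛-suc (qpow (suc e)) g n) (trans (ℤₚ.+-identityˡ _) (qpow-⊛ e g n))

shift-⊛-unfold : ∀ e (f g : Series) n → shift e (f ⊛ g) n ≡ f 0 * shift e g n + shift (suc e) ((f ∘ suc) ⊛ g) n
shift-⊛-unfold zero f g zero = refl
shift-⊛-unfold zero f g (suc n) = ⊛-suc f g n
shift-⊛-unfold (suc e) f g zero = sym (trans (ℤₚ.+-identityʳ _) (ℤₚ.*-zeroʳ (f 0)))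
shift-⊛-unfold (suc e) f g (suc n) = shift-⊛-unfold e f g n

⊛-shiftʳ : ∀ e (f g : Series) → f ⊛ shift e g ≗ shift e (f ⊛ g)
⊛-shiftʳ zero f g n = refl
⊛-shiftʳ (suc e) f g zero = trans (ℤₚ.+-identityʳ _) (ℤₚ.*-zeroʳ (f 0))
⊛-shiftʳ (suc e) f g (suc n) = begin
  (f ⊛ shift (suc e) g) (suc n)
    ≡⟨ ⊛-suc f (shift (suc e) g) n ⟩
  f 0 * shift e g n + ((f ∘ suc) ⊛ shift (suc e) g) n
    ≡⟨ cong (_+_ (f 0 * shift e g n)) (⊛-shiftʳ (suc e) (f ∘ suc) g n) ⟩
  f 0 * shift e g n + shift (suc e) ((f ∘ suc) ⊛ g) n
    ≡⟨ shift-⊛-unfold e f g n ⟨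
  shift e (f ⊛ g) n ∎

-- Geometric series

geom-period : ∀ a x → geom a (a ℕ.+ x) ≡ geom a x
geom-period a x =
  𝟙-⇔ (a ∣? a ℕ.+ x) (a ∣? x) (λ a∣a+x → ∣m+n∣m⇒∣n a∣a+x ∣-refl) (∣m∣n⇒∣m+n ∣-refl)

geom-unfold : ∀ a → geom (suc a) ≗ qpow 0 +ˢ shift (suc a) (geom (suc a))
geom-unfold a zero = 𝟙-yes (suc a ∣? 0) (suc a ∣0)
geom-unfold a (suc n) with n <? a
... | yes n<a = begin
  geom (suc a) (suc n)
    ≡⟨ 𝟙-no (suc a ∣? suc n) (λ a∣n → ℕₚ.<⇒≱ (s≤s n<a) (∣⇒≤ a∣n)) ⟩
  + 0
    ≡⟨ shift-below a (geom (suc a)) n<a ⟨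
  shift a (geom (suc a)) n
    ≡⟨ ℤₚ.+-identityˡ _ ⟨
  + 0 + shift a (geom (suc a)) n ∎
... | no n≮a = begin
  geom (suc a) (suc n)                 ≡⟨ cong (geom (suc a) ∘ suc) a+x≡n ⟨
  geom (suc a) (suc a ℕ.+ x)           ≡⟨ geom-period (suc a) x ⟩
  geom (suc a) x                       ≡⟨ shift-at a (geom (suc a)) x ⟨
  shift a (geom (suc a)) (a ℕ.+ x)     ≡⟨ cong (shift a (geom (suc a))) a+x≡n ⟩
  shift a (geom (suc a)) n             ≡⟨ ℤₚ.+-identityˡ _ ⟨
  + 0 + shift a (geom (suc a)) n       ∎
  where
  x = n ℕ.∸ a
  a+x≡n = ℕₚ.m+[n∸m]≡n (ℕₚ.≮⇒≥ n≮a)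

geom-rec : ∀ a (f : Series) → f ⊛ geom (suc a) ≗ f +ˢ shift (suc a) (f ⊛ geom (suc a))
geom-rec a f n = begin
  (f ⊛ G) n                                ≡⟨ ⊛-congʳ f (geom-unfold a) n ⟩
  (f ⊛ (qpow 0 +ˢ shift (suc a) G)) n      ≡⟨ ⊛-distribˡ-+ f (qpow 0) (shift (suc a) G) n ⟩
  (f ⊛ qpow 0) n + (f ⊛ shift (suc a) G) n ≡⟨ cong₂ _+_ (⊛-identityʳ f n) (⊛-shiftʳ (suc a) f G n) ⟩
  f n + shift (suc a) (f ⊛ G) n            ∎
  where G = geom (suc a)

geom-unique : ∀ a {f g : Series} → g ≗ f +ˢ shift (suc a) g → g ≗ f ⊛ geom (suc a)
geom-unique a {f} {g} eq = <-rec (λ n → g n ≡ (f ⊛ geom (suc a)) n) step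
  where
  step : ∀ n → (∀ {y} → y < n → g y ≡ (f ⊛ geom (suc a)) y) → g n ≡ (f ⊛ geom (suc a)) n
  step n below = begin
    g n                                      ≡⟨ eq n ⟩
    f n + shift (suc a) g n                  ≡⟨ cong (_+_ (f n)) (shift-suc-cong-< a below) ⟩
    f n + shift (suc a) (f ⊛ geom (suc a)) n ≡⟨ geom-rec a f n ⟨
    (f ⊛ geom (suc a)) n                     ∎

-- For w = f/((1 - q^a)(1 - q^b)), uniqueness for 1/(1 - q^b) gives w - q^a w = f/(1 - q^b);
-- so w solves the equation characterising f/((1 - q^b)(1 - q^a)).
⊛-geom-comm : ∀ a b (f : Series) → (f ⊛ geom (suc a)) ⊛ geom (suc b) ≗ (f ⊛ geom (suc b)) ⊛ geom (suc a)
⊛-geom-comm a b f = geom-unique a {v} {w} w-rec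
  where
  u = f ⊛ geom (suc a)
  v = f ⊛ geom (suc b)
  w = u ⊛ geom (suc b)

  z : Series
  z n = w n - shift (suc a) w n

  u-rec : ∀ n → u n - shift (suc a) u n ≡ f n
  u-rec n = trans (cong (_- shift (suc a) u n) (geom-rec a f n)) (cancel (f n) _)
    where
    cancel : ∀ x y → (x + y) - y ≡ x
    cancel = solve-∀

  z-rec : z ≗ f +ˢ shift (suc b) z
  z-rec n = begin
    w n - shift (suc a) w n
      ≡⟨ cong₂ _-_ (geom-rec b u n) (shift-fix (suc a) (suc b) (geom-rec b u) n) ⟩
    (u n + shift (suc b) w n) - (shift (suc a) u n + shift (suc b) (shift (suc a) w) n)
      ≡⟨ regroup (u n) _ _ _ ⟩
    (u n - shift (suc a) u n) + (shift (suc b) w n - shift (suc b) (shift (suc a) w) n)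
      ≡⟨ cong₂ _+_ (u-rec n) (sym (shift-- (suc b) w (shift (suc a) w) n)) ⟩
    f n + shift (suc b) z n ∎
    where
    regroup : ∀ x y x′ y′ → (x + y) - (x′ + y′) ≡ (x - x′) + (y - y′)
    regroup = solve-∀

  w-rec : w ≗ v +ˢ shift (suc a) w
  w-rec n = begin
    w n                         ≡⟨ split (w n) _ ⟩
    z n + shift (suc a) w n     ≡⟨ cong (_+ shift (suc a) w n) (geom-unique b {f} {z} z-rec n) ⟩
    v n + shift (suc a) w n     ∎
    where
    split : ∀ x y → x ≡ (x - y) + y
    split = solve-∀

-- Products over (q;q)_m

tri : ℕ → ℕ
tri m = m ℕ.* suc m ℕ./ 2

tri-suc : ∀ m → tri (suc m) ≡ suc m ℕ.+ tri m
tri-suc m = begin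
  suc m ℕ.* suc (suc m) ℕ./ 2          ≡⟨ cong (ℕ._/ 2) (expand m) ⟩
  (suc m ℕ.* 2 ℕ.+ m ℕ.* suc m) ℕ./ 2  ≡⟨ +-distrib-/-∣ˡ (m ℕ.* suc m) (divides (suc m) refl) ⟩
  suc m ℕ.* 2 ℕ./ 2 ℕ.+ tri m          ≡⟨ cong (ℕ._+ tri m) (m*n/n≡m (suc m) 2) ⟩
  suc m ℕ.+ tri m                      ∎
  where
  expand : ∀ m → suc m ℕ.* suc (suc m) ≡ suc m ℕ.* 2 ℕ.+ m ℕ.* suc m
  expand = ℕ-Solver.solve-∀

shift-tri-fix : ∀ m {X Y : Series} → X ≗ Y +ˢ shift (suc m) X →
  shift (tri (suc m)) X ≗ shift (suc m) (shift (tri m) Y) +ˢ shift (suc m) (shift (tri (suc m)) X)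
shift-tri-fix m {X} {Y} eq n = begin
  shift (tri (suc m)) X n
    ≡⟨ shift-fix (tri (suc m)) (suc m) eq n ⟩
  shift (tri (suc m)) Y n + shift (suc m) (shift (tri (suc m)) X) n
    ≡⟨ cong₂ _+_ (cong (λ e → shift e Y n) (tri-suc m)) refl ⟩
  shift (suc m ℕ.+ tri m) Y n + shift (suc m) (shift (tri (suc m)) X) n
    ≡⟨ cong₂ _+_ (shift-shift (suc m) (tri m) Y n) refl ⟨
  shift (suc m) (shift (tri m) Y) n + shift (suc m) (shift (tri (suc m)) X) n ∎

distinctProduct : ℕ → Series
distinctProduct m = shift (tri m) (poch⁻¹ m)

qTerm : ℕ → ℕ → Series
qTerm m a = shift (tri m) (poch⁻¹ m ⊛ geom a)

kthPartProduct : ℕ → ℕ → Series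
kthPartProduct m k n = ∑[ j ∈ upTo k ] qTerm m (m ℕ.∸ j) n

kthPartProduct-snoc : ∀ m k n → kthPartProduct m (suc k) n ≡ kthPartProduct m k n + qTerm m (m ℕ.∸ k) n
kthPartProduct-snoc m k n = ∑-upTo-snoc (λ j → qTerm m (m ℕ.∸ j) n) k

distinctProduct-rec : ∀ m →
  distinctProduct (suc m) ≗ shift (suc m) (distinctProduct m) +ˢ shift (suc m) (distinctProduct (suc m))
distinctProduct-rec m = shift-tri-fix m (geom-rec m (poch⁻¹ m))

poch⁻¹-geom-rec : ∀ m a →
  poch⁻¹ (suc m) ⊛ geom (suc a) ≗ (poch⁻¹ m ⊛ geom (suc a)) +ˢ shift (suc m) (poch⁻¹ (suc m) ⊛ geom (suc a))
poch⁻¹-geom-rec m a n = begin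
  ((P ⊛ geom (suc m)) ⊛ geom (suc a)) n
    ≡⟨ ⊛-geom-comm m a P n ⟩
  ((P ⊛ geom (suc a)) ⊛ geom (suc m)) n
    ≡⟨ geom-rec m (P ⊛ geom (suc a)) n ⟩
  (P ⊛ geom (suc a)) n + shift (suc m) ((P ⊛ geom (suc a)) ⊛ geom (suc m)) n
    ≡⟨ cong (_+_ ((P ⊛ geom (suc a)) n)) (shift-cong (suc m) (sym ∘ ⊛-geom-comm m a P) n) ⟩
  (P ⊛ geom (suc a)) n + shift (suc m) ((P ⊛ geom (suc m)) ⊛ geom (suc a)) n ∎
  where P = poch⁻¹ m

qTerm-rec : ∀ m {b} → 0 < b → qTerm (suc m) b ≗ shift (suc m) (qTerm m b) +ˢ shift (suc m) (qTerm (suc m) b)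
qTerm-rec m {suc a} _ = shift-tri-fix m (poch⁻¹-geom-rec m a)

qTerm-diag : ∀ m → qTerm (suc m) (suc m) ≗ distinctProduct (suc m) +ˢ shift (suc m) (qTerm (suc m) (suc m))
qTerm-diag m = shift-fix (tri (suc m)) (suc m) (geom-rec m (poch⁻¹ (suc m)))

kthPartProduct-rec : ∀ {m k} → k ≤ m →
  kthPartProduct (suc m) (suc k) ≗
    shift (suc m) (distinctProduct m +ˢ kthPartProduct m k) +ˢ
    shift (suc m) (distinctProduct (suc m) +ˢ kthPartProduct (suc m) (suc k))
kthPartProduct-rec {m} {zero} _ n = begin
  qTerm M M n + + 0
    ≡⟨ ℤₚ.+-identityʳ _ ⟩
  qTerm M M n
    ≡⟨ qTerm-diag m n ⟩
  P M n + S (qTerm M M) n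
    ≡⟨ cong₂ _+_ (distinctProduct-rec m n) refl ⟩
  (S (P m) n + S (P M) n) + S (qTerm M M) n
    ≡⟨ ℤₚ.+-assoc (S (P m) n) _ _ ⟩
  S (P m) n + (S (P M) n + S (qTerm M M) n)
    ≡⟨ cong₂ _+_ (shift-cong M (λ y → ℤₚ.+-identityʳ (P m y)) n) (shift-+ M (P M) (qTerm M M) n) ⟨
  S (P m +ˢ K m 0) n + S (P M +ˢ qTerm M M) n
    ≡⟨ cong (_+_ (S (P m +ˢ K m 0) n)) (shift-cong M (λ y → cong (_+_ (P M y)) (sym (ℤₚ.+-identityʳ _))) n) ⟩
  S (P m +ˢ K m 0) n + S (P M +ˢ K M 1) n ∎
  where
  M = suc m
  S = shift M
  P = distinctProduct
  K = kthPartProduct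
kthPartProduct-rec {m} {suc k} k<m n = begin
  K M (suc (suc k)) n
    ≡⟨ kthPartProduct-snoc M (suc k) n ⟩
  K M (suc k) n + Q M n
    ≡⟨ cong₂ _+_ (kthPartProduct-rec (ℕₚ.<⇒≤ k<m) n) (qTerm-rec m (ℕₚ.m<n⇒0<n∸m k<m) n) ⟩
  (S (P m +ˢ K m k) n + S (P M +ˢ K M (suc k)) n) + (S (Q m) n + S (Q M) n)
    ≡⟨ interchange ℤₚ.+-commutativeSemigroup (S (P m +ˢ K m k) n) _ _ _ ⟩
  (S (P m +ˢ K m k) n + S (Q m) n) + (S (P M +ˢ K M (suc k)) n + S (Q M) n)
    ≡⟨ cong₂ _+_ (shift-+ M (P m +ˢ K m k) (Q m) n) (shift-+ M (P M +ˢ K M (suc k)) (Q M) n) ⟨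
  S (P m +ˢ K m k +ˢ Q m) n + S (P M +ˢ K M (suc k) +ˢ Q M) n
    ≡⟨ cong₂ _+_ (shift-cong M (regroup m k) n) (shift-cong M (regroup M (suc k)) n) ⟩
  S (P m +ˢ K m (suc k)) n + S (P M +ˢ K M (suc (suc k))) n ∎
  where
  M = suc m
  S = shift M
  P = distinctProduct
  K = kthPartProduct
  Q = λ m′ → qTerm m′ (m ℕ.∸ k)
  regroup : ∀ m′ k′ → P m′ +ˢ K m′ k′ +ˢ qTerm m′ (m′ ℕ.∸ k′) ≗ P m′ +ˢ K m′ (suc k′)
  regroup m′ k′ y = trans (ℤₚ.+-assoc (P m′ y) _ _) (cong (_+_ (P m′ y)) (sym (kthPartProduct-snoc m′ k′ y)))

-- Subsets of {1, …, N}

parts : ℕ → List ℕ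
parts N = map suc (upTo N)

parts-suc : ∀ N → parts (suc N) ≡ 1 ∷ map suc (parts N)
parts-suc N = cong (1 ∷_) (begin
  map suc (applyUpTo suc N)   ≡⟨ map-applyUpTo suc suc N ⟩
  applyUpTo (suc ∘ suc) N     ≡⟨ map-upTo (suc ∘ suc) N ⟨
  map (suc ∘ suc) (upTo N)    ≡⟨ map-∘ (upTo N) ⟩
  map suc (map suc (upTo N))  ∎)

length-parts : ∀ N → length (parts N) ≡ N
length-parts N = trans (length-map suc (upTo N)) (length-upTo N)

sublists-map : ∀ (f : ℕ → ℕ) xs → sublists (map f xs) ≡ map (map f) (sublists xs)
sublists-map f [] = refl
sublists-map f (x ∷ xs) = begin
  map (f x ∷_) (sublists (map f xs)) ++ sublists (map f xs)
    ≡⟨ cong (λ S → map (f x ∷_) S ++ S) (sublists-map f xs) ⟩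
  map (f x ∷_) (map (map f) S) ++ map (map f) S
    ≡⟨ cong (_++ map (map f) S) (trans (sym (map-∘ S)) (map-∘ S)) ⟩
  map (map f) (map (x ∷_) S) ++ map (map f) S
    ≡⟨ map-++ (map f) (map (x ∷_) S) S ⟨
  map (map f) (map (x ∷_) S ++ S) ∎
  where S = sublists xs

sublists-length : ∀ xs → All (λ π → length π ≤ length xs) (sublists xs)
sublists-length [] = z≤n ∷ []
sublists-length (x ∷ xs) = ++⁺ (map⁺ (All.map s≤s below)) (All.map ℕₚ.m≤n⇒m≤1+n below)
  where below = sublists-length xs

∑-sublists-parts-suc : ∀ N (ω : List ℕ → ℤ) →
  ∑ (sublists (parts (suc N))) ω ≡
    (∑[ π ∈ sublists (parts N) ] ω (1 ∷ map suc π)) + (∑[ π ∈ sublists (parts N) ] ω (map suc π))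
∑-sublists-parts-suc N ω = begin
  ∑ (sublists (parts (suc N))) ω
    ≡⟨ cong (λ xs → ∑ (sublists xs) ω) (parts-suc N) ⟩
  ∑ (map (1 ∷_) (sublists (map suc (parts N))) ++ sublists (map suc (parts N))) ω
    ≡⟨ cong (λ S′ → ∑ (map (1 ∷_) S′ ++ S′) ω) (sublists-map suc (parts N)) ⟩
  ∑ (map (1 ∷_) (map (map suc) S) ++ map (map suc) S) ω
    ≡⟨ ∑-++ ω (map (1 ∷_) (map (map suc) S)) (map (map suc) S) ⟩
  ∑ (map (1 ∷_) (map (map suc) S)) ω + ∑ (map (map suc) S) ω
    ≡⟨ cong₂ _+_ (trans (∑-map ω (1 ∷_) (map (map suc) S)) (∑-map (ω ∘ (1 ∷_)) (map suc) S))
                 (∑-map ω (map suc) S) ⟩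
  (∑[ π ∈ S ] ω (1 ∷ map suc π)) + (∑[ π ∈ S ] ω (map suc π)) ∎
  where S = sublists (parts N)

sum-map-suc : ∀ π → sum (map suc π) ≡ sum π ℕ.+ length π
sum-map-suc [] = refl
sum-map-suc (x ∷ π) = trans (cong (λ t → suc (x ℕ.+ t)) (sum-map-suc π)) (shuffle x (sum π) (length π))
  where
  shuffle : ∀ x σ ℓ → suc (x ℕ.+ (σ ℕ.+ ℓ)) ≡ x ℕ.+ σ ℕ.+ suc ℓ
  shuffle = ℕ-Solver.solve-∀

cell : ℕ → ℕ → ℤ → List ℕ → ℤ
cell m n v π = δ (length π) m * (δ (sum π) n * v)

cell-shift : ∀ a m n v π π′ →
             length π′ ≡ a ℕ.+ length π → sum π′ ≡ sum π ℕ.+ (a ℕ.+ length π) →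
             cell (a ℕ.+ m) n v π′ ≡ shift (a ℕ.+ m) (λ y → cell m y v π) n
cell-shift a m n v π π′ len-eq sum-eq = begin
  δ (length π′) (a ℕ.+ m) * (δ (sum π′) n * v)
    ≡⟨ cong₂ (λ ℓ σ → δ ℓ (a ℕ.+ m) * (δ σ n * v)) len-eq sum-eq ⟩
  δ (a ℕ.+ ℓ) (a ℕ.+ m) * (δ (σ ℕ.+ (a ℕ.+ ℓ)) n * v)
    ≡⟨ cong (_* (δ (σ ℕ.+ (a ℕ.+ ℓ)) n * v)) (δ-+ a) ⟩
  δ ℓ m * (δ (σ ℕ.+ (a ℕ.+ ℓ)) n * v)
    ≡⟨ δ-*-cong {ℓ} {m} (λ ℓ≡m → cong (λ t → δ (σ ℕ.+ (a ℕ.+ t)) n * v) ℓ≡m) ⟩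
  δ ℓ m * (δ (σ ℕ.+ (a ℕ.+ m)) n * v)
    ≡⟨ cong (λ t → δ ℓ m * (t * v)) (δ-shift σ (a ℕ.+ m) n) ⟩
  δ ℓ m * (shift (a ℕ.+ m) (δ σ) n * v)
    ≡⟨ cong (δ ℓ m *_) (shift-*ʳ v (a ℕ.+ m) (δ σ) n) ⟨
  δ ℓ m * shift (a ℕ.+ m) (λ y → δ σ y * v) n
    ≡⟨ shift-*ˡ (δ ℓ m) (a ℕ.+ m) (λ y → δ σ y * v) n ⟨
  shift (a ℕ.+ m) (λ y → cell m y v π) n ∎
  where
  ℓ = length π
  σ = sum π

cell-map-suc : ∀ m n v π → cell m n v (map suc π) ≡ shift m (λ y → cell m y v π) n
cell-map-suc m n v π = cell-shift 0 m n v π (map suc π) (length-map suc π) (sum-map-suc π)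

cell-cons-one : ∀ m n v π → cell (suc m) n v (1 ∷ map suc π) ≡ shift (suc m) (λ y → cell m y v π) n
cell-cons-one m n v π = cell-shift 1 m n v π (1 ∷ map suc π) (cong suc (length-map suc π)) sum-eq
  where
  sum-eq : suc (sum (map suc π)) ≡ sum π ℕ.+ suc (length π)
  sum-eq = trans (cong suc (sum-map-suc π)) (sym (ℕₚ.+-suc (sum π) (length π)))

subsetGF : ℕ → ℕ → (List ℕ → ℤ) → Series
subsetGF N m c n = ∑[ π ∈ sublists (parts N) ] cell m n (c π) π

subsetGF-suc : ∀ N m (c : List ℕ → ℤ) →
  subsetGF (suc N) (suc m) c ≗
    shift (suc m) (subsetGF N m (c ∘ (1 ∷_) ∘ map suc)) +ˢ shift (suc m) (subsetGF N (suc m) (c ∘ map suc))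
subsetGF-suc N m c n = begin
  subsetGF (suc N) (suc m) c n
    ≡⟨ ∑-sublists-parts-suc N (λ π → cell (suc m) n (c π) π) ⟩
  (∑[ π ∈ S ] cell (suc m) n (c (1 ∷ map suc π)) (1 ∷ map suc π)) +
  (∑[ π ∈ S ] cell (suc m) n (c (map suc π)) (map suc π))
    ≡⟨ cong₂ _+_ (∑-cong S (λ π → cell-cons-one m n (c (1 ∷ map suc π)) π))
                 (∑-cong S (λ π → cell-map-suc (suc m) n (c (map suc π)) π)) ⟩
  (∑[ π ∈ S ] shift (suc m) (λ y → cell m y (c (1 ∷ map suc π)) π) n) +
  (∑[ π ∈ S ] shift (suc m) (λ y → cell (suc m) y (c (map suc π)) π) n)
    ≡⟨ cong₂ _+_ (shift-∑ (suc m) (λ π y → cell m y (c (1 ∷ map suc π)) π) S n)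
                 (shift-∑ (suc m) (λ π y → cell (suc m) y (c (map suc π)) π) S n) ⟨
  shift (suc m) (subsetGF N m (c ∘ (1 ∷_) ∘ map suc)) n + shift (suc m) (subsetGF N (suc m) (c ∘ map suc)) n ∎
  where S = sublists (parts N)

subsetGF-suc-zero : ∀ N (c : List ℕ → ℤ) → subsetGF (suc N) 0 c ≗ subsetGF N 0 (c ∘ map suc)
subsetGF-suc-zero N c n = begin
  subsetGF (suc N) 0 c n
    ≡⟨ ∑-sublists-parts-suc N (λ π → cell 0 n (c π) π) ⟩
  (∑[ π ∈ S ] + 0) + (∑[ π ∈ S ] cell 0 n (c (map suc π)) (map suc π))
    ≡⟨ cong₂ _+_ (∑-zero S) (∑-cong S (λ π → cell-map-suc 0 n (c (map suc π)) π)) ⟩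
  + 0 + subsetGF N 0 (c ∘ map suc) n
    ≡⟨ ℤₚ.+-identityˡ _ ⟩
  subsetGF N 0 (c ∘ map suc) n ∎
  where S = sublists (parts N)

subsetGF-cong : ∀ N m {c c′ : List ℕ → ℤ} → (∀ π → length π ≡ m → c π ≡ c′ π) →
                subsetGF N m c ≗ subsetGF N m c′
subsetGF-cong N m eq n =
  ∑-cong (sublists (parts N)) (λ π → δ-*-cong {length π} {m} (cong (δ (sum π) n *_) ∘ eq π))

subsetGF-+ : ∀ N m (c c′ : List ℕ → ℤ) →
             subsetGF N m (λ π → c π + c′ π) ≗ subsetGF N m c +ˢ subsetGF N m c′
subsetGF-+ N m c c′ n = trans (∑-cong S (λ π → distrib (δ (length π) m) (δ (sum π) n) (c π) (c′ π)))
                              (∑-+ (λ π → cell m n (c π) π) (λ π → cell m n (c′ π) π) S)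
  where
  S = sublists (parts N)
  distrib : ∀ a b x y → a * (b * (x + y)) ≡ a * (b * x) + a * (b * y)
  distrib = solve-∀

subsetGF-zero : ∀ N m → subsetGF N m (λ _ → + 0) ≗ λ _ → + 0
subsetGF-zero N m n = trans (∑-cong S vanish) (∑-zero S)
  where
  S = sublists (parts N)
  vanish : ∀ π → cell m n (+ 0) π ≡ + 0
  vanish π = trans (cong (δ (length π) m *_) (ℤₚ.*-zeroʳ (δ (sum π) n))) (ℤₚ.*-zeroʳ (δ (length π) m))

countGF : ℕ → ℕ → Series
countGF N m = subsetGF N m (λ _ → + 1)

kthPartGF : ℕ → ℕ → ℕ → Series
kthPartGF N k m = subsetGF N m (λ π → + s k π)

s-map-suc : ∀ k π → suc k ≤ length π → s (suc k) (map suc π) ≡ suc (s (suc k) π)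
s-map-suc zero (x ∷ π) _ = refl
s-map-suc (suc k) (x ∷ π) (s≤s k<ℓ) = s-map-suc k π k<ℓ

s-cons-one : ∀ k π → k ≤ length π → s (suc k) (1 ∷ map suc π) ≡ suc (s k π)
s-cons-one zero π _ = refl
s-cons-one (suc k) π k<ℓ = s-map-suc k π k<ℓ

s-short : ∀ k π → length π < k → s k π ≡ 0
s-short (suc k) [] _ = refl
s-short (suc zero) (x ∷ π) (s≤s ())
s-short (suc (suc k)) (x ∷ π) (s≤s ℓ<k) = s-short (suc k) π ℓ<k

countGF-suc : ∀ N m →
  countGF (suc N) (suc m) ≗ shift (suc m) (countGF N m) +ˢ shift (suc m) (countGF N (suc m))
countGF-suc N m = subsetGF-suc N m (λ _ → + 1)

kthPartGF-suc : ∀ N {k m} → k ≤ m →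
  kthPartGF (suc N) (suc k) (suc m) ≗
    shift (suc m) (countGF N m +ˢ kthPartGF N k m) +ˢ
    shift (suc m) (countGF N (suc m) +ˢ kthPartGF N (suc k) (suc m))
kthPartGF-suc N {k} {m} k≤m n = trans (subsetGF-suc N m (λ π → + s (suc k) π) n) (cong₂ _+_
  (shift-cong (suc m) (λ y → trans (subsetGF-cong N m containing-one y) (subsetGF-+ N m _ _ y)) n)
  (shift-cong (suc m) (λ y → trans (subsetGF-cong N (suc m) avoiding-one y) (subsetGF-+ N (suc m) _ _ y)) n))
  where
  containing-one : ∀ π → length π ≡ m → + s (suc k) (1 ∷ map suc π) ≡ + 1 + + s k π
  containing-one π ℓ≡m = cong +_ (s-cons-one k π (subst (k ≤_) (sym ℓ≡m) k≤m))
  avoiding-one : ∀ π → length π ≡ suc m → + s (suc k) (map suc π) ≡ + 1 + + s (suc k) π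
  avoiding-one π ℓ≡m = cong +_ (s-map-suc k π (subst (suc k ≤_) (sym ℓ≡m) (s≤s k≤m)))

countGF-empty : ∀ N n → countGF N 0 n ≡ qpow 0 n
countGF-empty zero zero = refl
countGF-empty zero (suc n) = refl
countGF-empty (suc N) n = trans (subsetGF-suc-zero N (λ _ → + 1) n) (countGF-empty N n)

countGF≡distinctProduct : ∀ {N} m {n} → n ≤ N → countGF N m n ≡ distinctProduct m n
countGF≡distinctProduct {N} zero {n} _ = countGF-empty N n
countGF≡distinctProduct {zero} (suc m) {zero} _ = sym (distinctProduct-rec m 0)
countGF≡distinctProduct {suc N} (suc m) {n} n≤1+N = begin
  countGF (suc N) (suc m) n
    ≡⟨ countGF-suc N m n ⟩
  shift (suc m) (countGF N m) n + shift (suc m) (countGF N (suc m)) n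
    ≡⟨ cong₂ _+_ (shift-suc-cong-< m (below m)) (shift-suc-cong-< m (below (suc m))) ⟩
  shift (suc m) (distinctProduct m) n + shift (suc m) (distinctProduct (suc m)) n
    ≡⟨ distinctProduct-rec m n ⟨
  distinctProduct (suc m) n ∎
  where
  below : ∀ m′ {y} → y < n → countGF N m′ y ≡ distinctProduct m′ y
  below m′ y<n = countGF≡distinctProduct m′ (ℕₚ.≤-pred (ℕₚ.≤-trans y<n n≤1+N))

kthPartGF≡kthPartProduct : ∀ {N k m n} → k ≤ m → n ≤ N → kthPartGF N k m n ≡ kthPartProduct m k n
kthPartGF≡kthPartProduct {N} {zero} {m} {n} _ _ = subsetGF-zero N m n
kthPartGF≡kthPartProduct {zero} {suc k} {suc m} {zero} (s≤s k≤m) _ = sym (kthPartProduct-rec k≤m 0)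
kthPartGF≡kthPartProduct {suc N} {suc k} {suc m} {n} (s≤s k≤m) n≤1+N = begin
  kthPartGF (suc N) (suc k) (suc m) n
    ≡⟨ kthPartGF-suc N k≤m n ⟩
  S (countGF N m +ˢ kthPartGF N k m) n + S (countGF N (suc m) +ˢ kthPartGF N (suc k) (suc m)) n
    ≡⟨ cong₂ _+_ (shift-suc-cong-< m (below k≤m)) (shift-suc-cong-< m (below (s≤s k≤m))) ⟩
  S (distinctProduct m +ˢ kthPartProduct m k) n + S (distinctProduct (suc m) +ˢ kthPartProduct (suc m) (suc k)) n
    ≡⟨ kthPartProduct-rec k≤m n ⟨
  kthPartProduct (suc m) (suc k) n ∎
  where
  S = shift (suc m)
  below : ∀ {k′ m′} → k′ ≤ m′ → ∀ {y} → y < n →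
          (countGF N m′ +ˢ kthPartGF N k′ m′) y ≡ (distinctProduct m′ +ˢ kthPartProduct m′ k′) y
  below k′≤m′ y<n = cong₂ _+_ (countGF≡distinctProduct _ y≤N) (kthPartGF≡kthPartProduct k′≤m′ y≤N)
    where y≤N = ℕₚ.≤-pred (ℕₚ.≤-trans y<n n≤1+N)

∑-term : ∀ m k n → ∑[ j ∈ upTo k ] term m j n ≡ neg1^ m * kthPartProduct m k n
∑-term m k n =
  trans (∑-cong (upTo k) (λ j → cong (neg1^ m *_) (qpow-⊛ (tri m) (poch⁻¹ m ⊛ geom (m ℕ.∸ j)) n)))
        (∑-*ˡ (neg1^ m) (λ j → qTerm m (m ℕ.∸ j) n) (upTo k))

-- Only the index i = #π - k survives, and then the sign is (-1)^{#π}.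
∑-signed-cell : ∀ {k} M n π → 0 < k → length π ≤ M →
  ∑[ i ∈ upTo M ] neg1^ (k ℕ.+ i) * cell (k ℕ.+ i) n (+ s k π) π ≡
    δ (sum π) n * (neg1^ (length π) * + s k π)
∑-signed-cell {k} M n π 0<k ℓ≤M with k ℕ.≤? length π
... | yes k≤ℓ = begin
  ∑[ i ∈ upTo M ] neg1^ (k ℕ.+ i) * (δ ℓ (k ℕ.+ i) * x)
    ≡⟨ ∑-cong (upTo M) reindex ⟩
  ∑[ i ∈ upTo M ] δ d i * (neg1^ (k ℕ.+ i) * x)
    ≡⟨ ∑-upTo-δ (λ i → neg1^ (k ℕ.+ i) * x) d<M ⟩
  neg1^ (k ℕ.+ d) * x
    ≡⟨ cong (λ t → neg1^ t * x) k+d≡ℓ ⟩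
  neg1^ ℓ * (δ (sum π) n * + s k π)
    ≡⟨ swap (neg1^ ℓ) (δ (sum π) n) (+ s k π) ⟩
  δ (sum π) n * (neg1^ ℓ * + s k π) ∎
  where
  ℓ = length π
  d = ℓ ℕ.∸ k
  x = δ (sum π) n * + s k π
  k+d≡ℓ = ℕₚ.m+[n∸m]≡n k≤ℓ
  d<M = ℕₚ.<-≤-trans (ℕₚ.∸-monoʳ-< 0<k k≤ℓ) ℓ≤M
  swap : ∀ a b c → a * (b * c) ≡ b * (a * c)
  swap = solve-∀
  reindex : ∀ i → neg1^ (k ℕ.+ i) * (δ ℓ (k ℕ.+ i) * x) ≡ δ d i * (neg1^ (k ℕ.+ i) * x)
  reindex i = begin
    neg1^ (k ℕ.+ i) * (δ ℓ (k ℕ.+ i) * x)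
      ≡⟨ cong (λ t → neg1^ (k ℕ.+ i) * (δ t (k ℕ.+ i) * x)) k+d≡ℓ ⟨
    neg1^ (k ℕ.+ i) * (δ (k ℕ.+ d) (k ℕ.+ i) * x)
      ≡⟨ cong (λ t → neg1^ (k ℕ.+ i) * (t * x)) (δ-+ k) ⟩
    neg1^ (k ℕ.+ i) * (δ d i * x)
      ≡⟨ swap (neg1^ (k ℕ.+ i)) (δ d i) x ⟩
    δ d i * (neg1^ (k ℕ.+ i) * x) ∎
... | no k≰ℓ rewrite s-short k π (ℕₚ.≰⇒> k≰ℓ) = begin
  ∑[ i ∈ upTo M ] neg1^ (k ℕ.+ i) * (δ (length π) (k ℕ.+ i) * (δ (sum π) n * + 0))
    ≡⟨ ∑-cong (upTo M) (λ i → vanish (neg1^ (k ℕ.+ i)) (δ (length π) (k ℕ.+ i)) (δ (sum π) n)) ⟩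
  ∑[ i ∈ upTo M ] + 0
    ≡⟨ ∑-zero (upTo M) ⟩
  + 0
    ≡⟨ trans (cong (δ (sum π) n *_) (ℤₚ.*-zeroʳ (neg1^ (length π)))) (ℤₚ.*-zeroʳ (δ (sum π) n)) ⟨
  δ (sum π) n * (neg1^ (length π) * + 0) ∎
  where
  vanish : ∀ a b c → a * (b * (c * + 0)) ≡ + 0
  vanish a b c = trans (cong (a *_) (trans (cong (b *_) (ℤₚ.*-zeroʳ c)) (ℤₚ.*-zeroʳ b))) (ℤₚ.*-zeroʳ a)

rhsPartial≡FFW : ∀ {k M n} → 0 < k → n ≤ M → rhsPartial k M n ≡ FFW k n
rhsPartial≡FFW {k} {M} {n} 0<k n≤M = begin
  rhsPartial k M n
    ≡⟨ ∑-swap (λ j i → term (k ℕ.+ i) j n) (upTo k) (upTo M) ⟩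
  ∑[ i ∈ upTo M ] ∑[ j ∈ upTo k ] term (k ℕ.+ i) j n
    ≡⟨ ∑-cong (upTo M) (λ i → trans (∑-term (k ℕ.+ i) k n)
         (cong (neg1^ (k ℕ.+ i) *_) (sym (kthPartGF≡kthPartProduct (ℕₚ.m≤m+n k i) ℕₚ.≤-refl)))) ⟩
  ∑[ i ∈ upTo M ] neg1^ (k ℕ.+ i) * kthPartGF n k (k ℕ.+ i) n
    ≡⟨ ∑-cong (upTo M) (λ i → sym (∑-*ˡ (neg1^ (k ℕ.+ i)) (λ π → cell (k ℕ.+ i) n (+ s k π) π) S)) ⟩
  ∑[ i ∈ upTo M ] ∑[ π ∈ S ] neg1^ (k ℕ.+ i) * cell (k ℕ.+ i) n (+ s k π) π
    ≡⟨ ∑-swap (λ i π → neg1^ (k ℕ.+ i) * cell (k ℕ.+ i) n (+ s k π) π) (upTo M) S ⟩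
  ∑[ π ∈ S ] ∑[ i ∈ upTo M ] neg1^ (k ℕ.+ i) * cell (k ℕ.+ i) n (+ s k π) π
    ≡⟨ ∑-cong-All (All.map (λ {π} → ∑-signed-cell M n π 0<k) short) ⟩
  ∑[ π ∈ S ] δ (sum π) n * (neg1^ (length π) * + s k π)
    ≡⟨ ∑-filter (λ π → sum π ≟ n) (λ π → neg1^ (length π) * + s k π) S ⟨
  FFW k n ∎
  where
  S = sublists (parts n)
  short : All (λ π → length π ≤ M) S
  short = All.map (λ ℓ≤ → ℕₚ.≤-trans ℓ≤ (subst (_≤ M) (sym (length-parts n)) n≤M)) (sublists-length (parts n))

lhs≡FFW : ∀ k n → lhs k n ≡ FFW k n
lhs≡FFW zero zero = refl
lhs≡FFW (suc k) zero = refl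
lhs≡FFW k (suc n) = refl

theorem1p4 : (k : ℕ) → k ≥ 1 → (n : ℕ) →
    ∃[ N ] ((M : ℕ) → M ≥ N → rhsPartial k M n ≡ lhs k n)
theorem1p4 k k≥1 n = n , λ M M≥n → trans (rhsPartial≡FFW k≥1 M≥n) (sym (lhs≡FFW k n))
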